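{- Let $\mathcal C$ be a distributive category, $\Sigma'\colon\mathcal C\times\mathcal C\to\mathcal C$ a bifunctor, $B\colon\mathcal C^{op}\times\mathcal C\to\mathcal C$ a functor, $\Sigma X=\Sigma'(X,X)$, and let $\rho_{X,Y}\colon\Sigma'(X\times B(X,Y),X)\to B(X,\Sigma^\star(X+Y))$ be natural in $Y$ and dinatural in $X$. Define $\rho'_{X,Y}\colon\Sigma(X\times B(X,Y))\to B(X,\Sigma^\star(X+Y))$ by $\rho'_{X,Y}=B(\mathrm{id},\Sigma^\star[\mathrm{inl},\mathrm{id}])\circ\rho_{X,X+Y}\circ\Sigma'(\mathrm{id}\times B(\mathrm{id},\mathrm{inr}),\mathrm{fst})$. Let $\gamma\colon\mu\Sigma\to B(\mu\Sigma,\mu\Sigma)$ be the operational model of $\rho'$, i.e. the unique morphism with $\gamma\circ\iota=B(\mathrm{id},\nabla^\sharp)\circ\rho'_{\mu\Sigma,\mu\Sigma}\circ\Sigma\langle\mathrm{id},\gamma\rangle$. Then $\gamma$ is the unique morphism $g\colon\mu\Sigma\to B(\mu\Sigma,\mu\Sigma)$ satisfying $g\circ\iota=B(\mathrm{id},\nabla^\sharp)\circ\rho_{\mu\Sigma,\mu\Sigma}\circ\Sigma'(\langle\mathrm{id},g\rangle,\mathrm{id})$.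
   Context: A distributive category has finite products and coproducts with the canonical maps $X\times Y+X\times Z\to X\times(Y+Z)$ invertible. $\mathrm{inl},\mathrm{inr}$ are coproduct injections, $[f,g]$ copairing, $\langle f,g\rangle$ pairing, $\mathrm{fst}$ first projection, $\nabla=[\mathrm{id},\mathrm{id}]$. Free $\Sigma$-algebras are assumed to exist; $\Sigma^\star$ is the free monad on $\Sigma$ with multiplication $\mu^\Sigma$; $\mu\Sigma=\Sigma^\star 0$ is the initial $\Sigma$-algebra with structure $\iota\colon\Sigma\mu\Sigma=\Sigma'(\mu\Sigma,\mu\Sigma)\to\mu\Sigma$; $\nabla^\sharp=\mu^\Sigma_0\circ\Sigma^\star\nabla\colon\Sigma^\star(\mu\Sigma+\mu\Sigma)\to\mu\Sigma$. It is known that a unique $\gamma$ as in the claim (the operational model of $\rho'$) exists. -}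

module Defs where

open import Level using (Level; _⊔_) renaming (suc to lsuc)
open import Relation.Binary using (Rel; IsEquivalence)

record Category (o ℓ e : Level) : Set (lsuc (o ⊔ ℓ ⊔ e)) where
  infixr 9 _∘_
  infix 4 _≈_
  infixr 5 _⇒_
  field
    Obj : Set o
    _⇒_ : Obj → Obj → Set ℓ
    _≈_ : ∀ {A B} → Rel (A ⇒ B) e
    id : ∀ {A} → A ⇒ A
    _∘_ : ∀ {A B C} → B ⇒ C → A ⇒ B → A ⇒ C
    assoc : ∀ {A B C D} {f : A ⇒ B} {g : B ⇒ C} {h : C ⇒ D} →
            (h ∘ g) ∘ f ≈ h ∘ (g ∘ f)
    identityˡ : ∀ {A B} {f : A ⇒ B} → id ∘ f ≈ f
    identityʳ : ∀ {A B} {f : A ⇒ B} → f ∘ id ≈ f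
    equiv : ∀ {A B} → IsEquivalence (_≈_ {A} {B})
    ∘-resp-≈ : ∀ {A B C} {f h : B ⇒ C} {g i : A ⇒ B} →
               f ≈ h → g ≈ i → f ∘ g ≈ h ∘ i

record DistributiveCategory (o ℓ e : Level) : Set (lsuc (o ⊔ ℓ ⊔ e)) where
  field
    cat : Category o ℓ e
  open Category cat
  infixr 7 _×_
  infixr 6 _+_
  field
    𝟙 : Obj
    ! : ∀ {A} → A ⇒ 𝟙
    !-unique : ∀ {A} (f : A ⇒ 𝟙) → ! ≈ f
    _×_ : Obj → Obj → Obj
    fst : ∀ {A B} → A × B ⇒ A
    snd : ∀ {A B} → A × B ⇒ B
    ⟨_,_⟩ : ∀ {C A B} → C ⇒ A → C ⇒ B → C ⇒ A × B
    project₁ : ∀ {C A B} {f : C ⇒ A} {g : C ⇒ B} → fst ∘ ⟨ f , g ⟩ ≈ f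
    project₂ : ∀ {C A B} {f : C ⇒ A} {g : C ⇒ B} → snd ∘ ⟨ f , g ⟩ ≈ g
    ⟨⟩-unique : ∀ {C A B} {h : C ⇒ A × B} {f : C ⇒ A} {g : C ⇒ B} →
                fst ∘ h ≈ f → snd ∘ h ≈ g → ⟨ f , g ⟩ ≈ h
    𝟘 : Obj
    ¡ : ∀ {A} → 𝟘 ⇒ A
    ¡-unique : ∀ {A} (f : 𝟘 ⇒ A) → ¡ ≈ f
    _+_ : Obj → Obj → Obj
    inl : ∀ {A B} → A ⇒ A + B
    inr : ∀ {A B} → B ⇒ A + B
    [_,_] : ∀ {A B C} → A ⇒ C → B ⇒ C → A + B ⇒ C
    inject₁ : ∀ {A B C} {f : A ⇒ C} {g : B ⇒ C} → [ f , g ] ∘ inl ≈ f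
    inject₂ : ∀ {A B C} {f : A ⇒ C} {g : B ⇒ C} → [ f , g ] ∘ inr ≈ g
    []-unique : ∀ {A B C} {h : A + B ⇒ C} {f : A ⇒ C} {g : B ⇒ C} →
                h ∘ inl ≈ f → h ∘ inr ≈ g → [ f , g ] ≈ h

  infixr 8 _⁂_ _+₁_
  _⁂_ : ∀ {A B C D} → A ⇒ B → C ⇒ D → A × C ⇒ B × D
  f ⁂ g = ⟨ f ∘ fst , g ∘ snd ⟩

  _+₁_ : ∀ {A B C D} → A ⇒ B → C ⇒ D → A + C ⇒ B + D
  f +₁ g = [ inl ∘ f , inr ∘ g ]

  ∇ : ∀ {A} → A + A ⇒ A
  ∇ = [ id , id ]

  distribute : ∀ {X Y Z} → X × Y + X × Z ⇒ X × (Y + Z)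
  distribute = [ id ⁂ inl , id ⁂ inr ]

  field
    distribute⁻¹ : ∀ {X Y Z} → X × (Y + Z) ⇒ X × Y + X × Z
    distribute-isoˡ : ∀ {X Y Z} → distribute⁻¹ ∘ distribute {X} {Y} {Z} ≈ id
    distribute-isoʳ : ∀ {X Y Z} → distribute {X} {Y} {Z} ∘ distribute⁻¹ ≈ id

record Bifunctor {o ℓ e} (C : Category o ℓ e) : Set (o ⊔ ℓ ⊔ e) where
  open Category C
  field
    F₀ : Obj → Obj → Obj
    F₁ : ∀ {A A′ B B′} → A ⇒ A′ → B ⇒ B′ → F₀ A B ⇒ F₀ A′ B′
    identity : ∀ {A B} → F₁ (id {A}) (id {B}) ≈ id
    homomorphism : ∀ {A A′ A″ B B′ B″} {f : A ⇒ A′} {f′ : A′ ⇒ A″}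
                     {g : B ⇒ B′} {g′ : B′ ⇒ B″} →
                   F₁ (f′ ∘ f) (g′ ∘ g) ≈ F₁ f′ g′ ∘ F₁ f g
    F-resp-≈ : ∀ {A A′ B B′} {f h : A ⇒ A′} {g i : B ⇒ B′} →
               f ≈ h → g ≈ i → F₁ f g ≈ F₁ h i

record MixedBifunctor {o ℓ e} (C : Category o ℓ e) : Set (o ⊔ ℓ ⊔ e) where
  open Category C
  field
    F₀ : Obj → Obj → Obj
    F₁ : ∀ {A A′ B B′} → A′ ⇒ A → B ⇒ B′ → F₀ A B ⇒ F₀ A′ B′
    identity : ∀ {A B} → F₁ (id {A}) (id {B}) ≈ id
    homomorphism : ∀ {A A′ A″ B B′ B″} {f : A′ ⇒ A} {f′ : A″ ⇒ A′}
                     {g : B ⇒ B′} {g′ : B′ ⇒ B″} →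
                   F₁ (f ∘ f′) (g′ ∘ g) ≈ F₁ f′ g′ ∘ F₁ f g
    F-resp-≈ : ∀ {A A′ B B′} {f h : A′ ⇒ A} {g i : B ⇒ B′} →
               f ≈ h → g ≈ i → F₁ f g ≈ F₁ h i

record FreeAlgebras {o ℓ e} (C : Category o ℓ e) (S : Bifunctor C)
       : Set (o ⊔ ℓ ⊔ e) where
  open Category C
  open Bifunctor S
  field
    T : Obj → Obj
    η : ∀ {X} → X ⇒ T X
    α : ∀ {X} → F₀ (T X) (T X) ⇒ T X
    fold : ∀ {X A} → F₀ A A ⇒ A → X ⇒ A → T X ⇒ A
    fold-η : ∀ {X A} {a : F₀ A A ⇒ A} {f : X ⇒ A} → fold a f ∘ η ≈ f
    fold-α : ∀ {X A} {a : F₀ A A ⇒ A} {f : X ⇒ A} →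
             fold a f ∘ α ≈ a ∘ F₁ (fold a f) (fold a f)
    fold-unique : ∀ {X A} {a : F₀ A A ⇒ A} {f : X ⇒ A} {h : T X ⇒ A} →
                  h ∘ η ≈ f → h ∘ α ≈ a ∘ F₁ h h → h ≈ fold a f

module Setting {o ℓ e} (𝒞 : DistributiveCategory o ℓ e)
               (S : Bifunctor (DistributiveCategory.cat 𝒞))
               (B : MixedBifunctor (DistributiveCategory.cat 𝒞))
               (FA : FreeAlgebras (DistributiveCategory.cat 𝒞) S) where
  open DistributiveCategory 𝒞
  open Category cat
  open FreeAlgebras FA
  module S = Bifunctor S
  module B = MixedBifunctor B

  Σ′ : Obj → Obj → Obj
  Σ′ = S.F₀

  Σ′₁ : ∀ {A A′ B B′} → A ⇒ A′ → B ⇒ B′ → Σ′ A B ⇒ Σ′ A′ B′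
  Σ′₁ = S.F₁

  Σ₀ : Obj → Obj
  Σ₀ X = Σ′ X X

  Σ₁ : ∀ {X Y} → X ⇒ Y → Σ₀ X ⇒ Σ₀ Y
  Σ₁ f = Σ′₁ f f

  B₀ : Obj → Obj → Obj
  B₀ = B.F₀

  B₁ : ∀ {A A′ C C′} → A′ ⇒ A → C ⇒ C′ → B₀ A C ⇒ B₀ A′ C′
  B₁ = B.F₁

  Σ⋆ : Obj → Obj
  Σ⋆ = T

  Σ⋆₁ : ∀ {X Y} → X ⇒ Y → Σ⋆ X ⇒ Σ⋆ Y
  Σ⋆₁ f = fold α (η ∘ f)

  μˢ : ∀ {X} → Σ⋆ (Σ⋆ X) ⇒ Σ⋆ X
  μˢ = fold α id

  μΣ : Obj
  μΣ = Σ⋆ 𝟘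

  ι : Σ₀ μΣ ⇒ μΣ
  ι = α

  ∇♯ : Σ⋆ (μΣ + μΣ) ⇒ μΣ
  ∇♯ = μˢ {𝟘} ∘ Σ⋆₁ ∇

  RhoFamily : Set (o ⊔ ℓ)
  RhoFamily = ∀ X Y → Σ′ (X × B₀ X Y) X ⇒ B₀ X (Σ⋆ (X + Y))

  NaturalInY : RhoFamily → Set (o ⊔ ℓ ⊔ e)
  NaturalInY ρ = ∀ {X Y Y′} (g : Y ⇒ Y′) →
    B₁ id (Σ⋆₁ (id +₁ g)) ∘ ρ X Y ≈ ρ X Y′ ∘ Σ′₁ (id ⁂ B₁ id g) id

  DinaturalInX : RhoFamily → Set (o ⊔ ℓ ⊔ e)
  DinaturalInX ρ = ∀ {X X′ Y} (f : X ⇒ X′) →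
    B₁ id (Σ⋆₁ (f +₁ id)) ∘ ρ X Y ∘ Σ′₁ (id ⁂ B₁ f id) id
      ≈ B₁ f id ∘ ρ X′ Y ∘ Σ′₁ (f ⁂ id) f

  ρ′ : RhoFamily → ∀ X Y → Σ₀ (X × B₀ X Y) ⇒ B₀ X (Σ⋆ (X + Y))
  ρ′ ρ X Y = B₁ id (Σ⋆₁ [ inl , id ]) ∘ ρ X (X + Y) ∘ Σ′₁ (id ⁂ B₁ id inr) fst

  IsOperationalModel′ : RhoFamily → μΣ ⇒ B₀ μΣ μΣ → Set e
  IsOperationalModel′ ρ γ = γ ∘ ι ≈ B₁ id ∇♯ ∘ ρ′ ρ μΣ μΣ ∘ Σ₁ ⟨ id , γ ⟩

  IsOperationalModel : RhoFamily → μΣ ⇒ B₀ μΣ μΣ → Set e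
  IsOperationalModel ρ g = g ∘ ι ≈ B₁ id ∇♯ ∘ ρ μΣ μΣ ∘ Σ′₁ ⟨ id , g ⟩ id

module Submission where

-- Naturality of ρ in Y, instantiated at inr : Y → X + Y, moves the weakening
-- B(id,inr) inside ρ' out through ρ as Σ⋆(id + inr), which Σ⋆[inl,id] then
-- cancels; so for every g the defining equations of "g is an operational
-- model of ρ" and "of ρ'" have equal right-hand sides. An operational model
-- of ρ' is a definition by primitive recursion on μΣ: ⟨id,g⟩ is the fold of
-- the algebra ⟨ι ∘ Σfst, B(id,∇♯) ∘ ρ'⟩, so it is unique.

open import Defs
open import Data.Product using (_×_; _,_)
open import Relation.Binary.Bundles using (Setoid)
import Relation.Binary.Reasoning.Setoid as SetoidReasoning

module Development {o ℓ e} (𝒞 : DistributiveCategory o ℓ e)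
    (S : Bifunctor (DistributiveCategory.cat 𝒞))
    (B : MixedBifunctor (DistributiveCategory.cat 𝒞))
    (FA : FreeAlgebras (DistributiveCategory.cat 𝒞) S) where

  open DistributiveCategory 𝒞 renaming (_×_ to _⊗_)
  open Category cat
  open FreeAlgebras FA
  open Setting 𝒞 S B FA

  hom-setoid : Obj → Obj → Setoid ℓ e
  hom-setoid X Y = record { Carrier = X ⇒ Y ; _≈_ = _≈_ ; isEquivalence = equiv }

  module HomReasoning {X Y : Obj} = SetoidReasoning (hom-setoid X Y)
  open HomReasoning
  module HomEquivalence {X Y : Obj} = Setoid (hom-setoid X Y)
  open HomEquivalence public using (refl; sym; trans)

  ∘-resp-≈ˡ : ∀ {X Y Z} {f f′ : Y ⇒ Z} {g : X ⇒ Y} → f ≈ f′ → f ∘ g ≈ f′ ∘ g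
  ∘-resp-≈ˡ p = ∘-resp-≈ p refl

  ∘-resp-≈ʳ : ∀ {X Y Z} {f : Y ⇒ Z} {g g′ : X ⇒ Y} → g ≈ g′ → f ∘ g ≈ f ∘ g′
  ∘-resp-≈ʳ p = ∘-resp-≈ refl p

  pullˡ : ∀ {W X Y Z} {f : Y ⇒ Z} {g : X ⇒ Y} {h : W ⇒ X} {k : X ⇒ Z} →
          f ∘ g ≈ k → f ∘ g ∘ h ≈ k ∘ h
  pullˡ p = trans (sym assoc) (∘-resp-≈ˡ p)

  Σ⋆₁-resp-≈ : ∀ {X Y} {f f′ : X ⇒ Y} → f ≈ f′ → Σ⋆₁ f ≈ Σ⋆₁ f′
  Σ⋆₁-resp-≈ p = fold-unique (trans fold-η (∘-resp-≈ʳ p)) fold-α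

  Σ⋆₁-identity : ∀ {X} → Σ⋆₁ (id {X}) ≈ id
  Σ⋆₁-identity = sym (fold-unique
    (trans identityˡ (sym identityʳ))
    (trans identityˡ (trans (sym identityʳ) (∘-resp-≈ʳ (sym S.identity)))))

  Σ⋆₁-homomorphism : ∀ {X Y Z} {f : X ⇒ Y} {g : Y ⇒ Z} →
                     Σ⋆₁ g ∘ Σ⋆₁ f ≈ Σ⋆₁ (g ∘ f)
  Σ⋆₁-homomorphism {f = f} {g} = fold-unique on-η on-α
    where
    on-η : (Σ⋆₁ g ∘ Σ⋆₁ f) ∘ η ≈ η ∘ (g ∘ f)
    on-η = begin
      (Σ⋆₁ g ∘ Σ⋆₁ f) ∘ η  ≈⟨ assoc ⟩
      Σ⋆₁ g ∘ Σ⋆₁ f ∘ η    ≈⟨ ∘-resp-≈ʳ fold-η ⟩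
      Σ⋆₁ g ∘ η ∘ f        ≈⟨ pullˡ fold-η ⟩
      (η ∘ g) ∘ f          ≈⟨ assoc ⟩
      η ∘ g ∘ f            ∎
    on-α : (Σ⋆₁ g ∘ Σ⋆₁ f) ∘ α ≈ α ∘ Σ₁ (Σ⋆₁ g ∘ Σ⋆₁ f)
    on-α = begin
      (Σ⋆₁ g ∘ Σ⋆₁ f) ∘ α               ≈⟨ assoc ⟩
      Σ⋆₁ g ∘ Σ⋆₁ f ∘ α                 ≈⟨ ∘-resp-≈ʳ fold-α ⟩
      Σ⋆₁ g ∘ α ∘ Σ₁ (Σ⋆₁ f)            ≈⟨ pullˡ fold-α ⟩
      (α ∘ Σ₁ (Σ⋆₁ g)) ∘ Σ₁ (Σ⋆₁ f)     ≈⟨ assoc ⟩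
      α ∘ Σ₁ (Σ⋆₁ g) ∘ Σ₁ (Σ⋆₁ f)       ≈⟨ ∘-resp-≈ʳ (sym S.homomorphism) ⟩
      α ∘ Σ₁ (Σ⋆₁ g ∘ Σ⋆₁ f)            ∎

  [inl,id]∘id+₁inr≈id : ∀ {X Y} → [ inl , id ] ∘ (id +₁ inr) ≈ id {X + Y}
  [inl,id]∘id+₁inr≈id = trans (sym ([]-unique on-inl on-inr)) ([]-unique identityˡ identityˡ)
    where
    on-inl : ([ inl , id ] ∘ (id +₁ inr)) ∘ inl ≈ inl
    on-inl = trans assoc (trans (∘-resp-≈ʳ inject₁) (trans (pullˡ inject₁) identityʳ))
    on-inr : ([ inl , id ] ∘ (id +₁ inr)) ∘ inr ≈ inr
    on-inr = trans assoc (trans (∘-resp-≈ʳ inject₂) (trans (pullˡ inject₂) identityˡ))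

  B₁-retraction : ∀ {A X Y} {f : X ⇒ Y} {r : Y ⇒ X} → r ∘ f ≈ id →
                  B₁ (id {A}) r ∘ B₁ id f ≈ id
  B₁-retraction p = trans (sym B.homomorphism) (trans (B.F-resp-≈ identityˡ p) B.identity)

  Σ⋆[inl,id]-cancels-Σ⋆[id+inr] : ∀ {A X Y} →
    B₁ (id {A}) (Σ⋆₁ [ inl , id ]) ∘ B₁ id (Σ⋆₁ (id +₁ inr)) ≈ id {B₀ A (Σ⋆ (X + Y))}
  Σ⋆[inl,id]-cancels-Σ⋆[id+inr] = B₁-retraction
    (trans Σ⋆₁-homomorphism (trans (Σ⋆₁-resp-≈ [inl,id]∘id+₁inr≈id) Σ⋆₁-identity))

  ρ′∘Σ₁≈ρ∘Σ′₁ : (ρ : RhoFamily) → NaturalInY ρ →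
                ∀ {X Y Z} (h : Z ⇒ X ⊗ B₀ X Y) →
                ρ′ ρ X Y ∘ Σ₁ h ≈ ρ X Y ∘ Σ′₁ h (fst ∘ h)
  ρ′∘Σ₁≈ρ∘Σ′₁ ρ natural {X} {Y} h = begin
    (contract ∘ ρ X (X + Y) ∘ Σ′₁ (id ⁂ B₁ id inr) fst) ∘ Σ₁ h
      ≈⟨ trans assoc (∘-resp-≈ʳ assoc) ⟩
    contract ∘ ρ X (X + Y) ∘ Σ′₁ (id ⁂ B₁ id inr) fst ∘ Σ₁ h
      ≈⟨ ∘-resp-≈ʳ (∘-resp-≈ʳ split-weakening) ⟩
    contract ∘ ρ X (X + Y) ∘ Σ′₁ (id ⁂ B₁ id inr) id ∘ Σ′₁ h (fst ∘ h)
      ≈⟨ ∘-resp-≈ʳ (pullˡ (sym (natural inr))) ⟩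
    contract ∘ (B₁ id (Σ⋆₁ (id +₁ inr)) ∘ ρ X Y) ∘ Σ′₁ h (fst ∘ h)
      ≈⟨ trans (∘-resp-≈ʳ assoc) (pullˡ Σ⋆[inl,id]-cancels-Σ⋆[id+inr]) ⟩
    id ∘ ρ X Y ∘ Σ′₁ h (fst ∘ h)
      ≈⟨ identityˡ ⟩
    ρ X Y ∘ Σ′₁ h (fst ∘ h)
      ∎
    where
    contract : B₀ X (Σ⋆ (X + (X + Y))) ⇒ B₀ X (Σ⋆ (X + Y))
    contract = B₁ id (Σ⋆₁ [ inl , id ])
    split-weakening : Σ′₁ (id ⁂ B₁ id inr) fst ∘ Σ₁ h
                      ≈ Σ′₁ (id ⁂ B₁ id inr) id ∘ Σ′₁ h (fst ∘ h)
    split-weakening = trans (sym S.homomorphism)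
      (trans (S.F-resp-≈ refl (sym identityˡ)) S.homomorphism)

  operational-models-agree : (ρ : RhoFamily) → NaturalInY ρ → (g : μΣ ⇒ B₀ μΣ μΣ) →
    B₁ id ∇♯ ∘ ρ′ ρ μΣ μΣ ∘ Σ₁ ⟨ id , g ⟩ ≈ B₁ id ∇♯ ∘ ρ μΣ μΣ ∘ Σ′₁ ⟨ id , g ⟩ id
  operational-models-agree ρ natural g = ∘-resp-≈ʳ (trans
    (ρ′∘Σ₁≈ρ∘Σ′₁ ρ natural ⟨ id , g ⟩)
    (∘-resp-≈ʳ (S.F-resp-≈ refl project₁)))

  primitive-recursion : ∀ {A} (k : Σ₀ (μΣ ⊗ A) ⇒ A) (g : μΣ ⇒ A) →
                        g ∘ ι ≈ k ∘ Σ₁ ⟨ id , g ⟩ →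
                        ⟨ id , g ⟩ ≈ fold ⟨ ι ∘ Σ₁ fst , k ⟩ ¡
  primitive-recursion k g g-rec = fold-unique (sym (¡-unique _)) (begin
    ⟨ id , g ⟩ ∘ α                          ≈⟨ sym (⟨⟩-unique (pullˡ project₁) (pullˡ project₂)) ⟩
    ⟨ id ∘ α , g ∘ α ⟩                      ≈⟨ ⟨⟩-unique first second ⟩
    ⟨ ι ∘ Σ₁ fst , k ⟩ ∘ Σ₁ ⟨ id , g ⟩      ∎)
    where
    first : fst ∘ ⟨ ι ∘ Σ₁ fst , k ⟩ ∘ Σ₁ ⟨ id , g ⟩ ≈ id ∘ α
    first = begin
      fst ∘ ⟨ ι ∘ Σ₁ fst , k ⟩ ∘ Σ₁ ⟨ id , g ⟩   ≈⟨ pullˡ project₁ ⟩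
      (ι ∘ Σ₁ fst) ∘ Σ₁ ⟨ id , g ⟩              ≈⟨ trans assoc (∘-resp-≈ʳ (sym S.homomorphism)) ⟩
      ι ∘ Σ₁ (fst ∘ ⟨ id , g ⟩)                 ≈⟨ ∘-resp-≈ʳ (trans (S.F-resp-≈ project₁ project₁) S.identity) ⟩
      ι ∘ id                                    ≈⟨ trans identityʳ (sym identityˡ) ⟩
      id ∘ α                                    ∎
    second : snd ∘ ⟨ ι ∘ Σ₁ fst , k ⟩ ∘ Σ₁ ⟨ id , g ⟩ ≈ g ∘ α
    second = trans (pullˡ project₂) (sym g-rec)

  primitive-recursion-unique : ∀ {A} (k : Σ₀ (μΣ ⊗ A) ⇒ A) {g g′ : μΣ ⇒ A} →
                               g ∘ ι ≈ k ∘ Σ₁ ⟨ id , g ⟩ →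
                               g′ ∘ ι ≈ k ∘ Σ₁ ⟨ id , g′ ⟩ → g ≈ g′
  primitive-recursion-unique k {g} {g′} g-rec g′-rec = begin
    g                           ≈⟨ sym project₂ ⟩
    snd ∘ ⟨ id , g ⟩            ≈⟨ ∘-resp-≈ʳ (primitive-recursion k g g-rec) ⟩
    snd ∘ fold _ ¡              ≈⟨ ∘-resp-≈ʳ (sym (primitive-recursion k g′ g′-rec)) ⟩
    snd ∘ ⟨ id , g′ ⟩           ≈⟨ project₂ ⟩
    g′                          ∎

  operational-model′-unique : (ρ : RhoFamily) {g g′ : μΣ ⇒ B₀ μΣ μΣ} →
                              IsOperationalModel′ ρ g → IsOperationalModel′ ρ g′ → g ≈ g′
  operational-model′-unique ρ g-model g′-model =
    primitive-recursion-unique (B₁ id ∇♯ ∘ ρ′ ρ μΣ μΣ)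
      (trans g-model (sym assoc)) (trans g′-model (sym assoc))

-- Dinaturality of ρ in X is part of the paper's setting but not needed here.
proposition2p2 : ∀ {o ℓ e} (𝒞 : DistributiveCategory o ℓ e)
    (S : Bifunctor (DistributiveCategory.cat 𝒞))
    (B : MixedBifunctor (DistributiveCategory.cat 𝒞))
    (FA : FreeAlgebras (DistributiveCategory.cat 𝒞) S) →
    let open Setting 𝒞 S B FA
        open Category (DistributiveCategory.cat 𝒞)
    in (ρ : RhoFamily) → NaturalInY ρ → DinaturalInX ρ →
       (γ : μΣ ⇒ B₀ μΣ μΣ) → IsOperationalModel′ ρ γ →
       IsOperationalModel ρ γ × (∀ (g : μΣ ⇒ B₀ μΣ μΣ) → IsOperationalModel ρ g → g ≈ γ)
proposition2p2 𝒞 S B FA ρ natural _ γ γ-model′ =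
  trans γ-model′ (operational-models-agree ρ natural γ) ,
  λ g g-model → operational-model′-unique ρ
    (trans g-model (sym (operational-models-agree ρ natural g))) γ-model′
  where
  open Development 𝒞 S B FA
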